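{- Every finite irreducibly odd graph contains the triskelion as a graph minor.
   Context: All graphs are finite and simple. A graph is \emph{odd} if every vertex has odd degree. A graph $G$ is \emph{irreducibly odd} if it is odd and for every pair of distinct vertices $u,v$ of $G$ there exists a third vertex $w \notin \{u,v\}$ that is adjacent to exactly one of $u$ and $v$. The \emph{triskelion} is the graph on six vertices $v_1,v_2,v_3,w_1,w_2,w_3$ consisting of the triangle $v_1v_2v_3$ together with the edges $v_1w_1, v_2w_2, v_3w_3$ (a triangle with a pendant vertex attached to each of its vertices). -}

module Defs where

open import Data.Nat using (ℕ; zero; suc; _%_; _≤_)
open import Data.Fin using (Fin; zero; suc)
open import Data.Bool using (Bool; true; false; _∨_; if_then_else_)
open import Data.Bool.Properties using (∨-comm)
open import Data.List using (List; map; allFin)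
open import Data.Nat.ListAction using (sum)
open import Data.Maybe using (Maybe; just; nothing)
open import Data.Product using (Σ; _×_; _,_; ∃; ∃-syntax)
open import Data.Sum using (_⊎_)
open import Relation.Nullary using (¬_)
open import Relation.Binary.PropositionalEquality using (_≡_; _≢_; refl)

record Graph : Set where
  field
    n     : ℕ
    adj   : Fin n → Fin n → Bool
    sym   : ∀ x y → adj x y ≡ adj y x
    irrefl : ∀ x → adj x x ≡ false

open Graph public

Adj : (G : Graph) → Fin (n G) → Fin (n G) → Set
Adj G x y = adj G x y ≡ true

degree : (G : Graph) → Fin (n G) → ℕ
degree G x = sum (map (λ y → if adj G x y then 1 else 0) (allFin (n G)))

IsOdd : Graph → Set
IsOdd G = ∀ x → degree G x % 2 ≡ 1

IrreduciblyOdd : Graph → Set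
IrreduciblyOdd G =
  IsOdd G ×
  (∀ u v → u ≢ v →
     ∃[ w ] (w ≢ u × w ≢ v ×
             ((Adj G w u × ¬ Adj G w v) ⊎ (¬ Adj G w u × Adj G w v))))

data WalkIn (G : Graph) (P : Fin (n G) → Set) : Fin (n G) → Fin (n G) → Set where
  here : ∀ {x} → P x → WalkIn G P x x
  step : ∀ {x y z} → P x → Adj G x y → WalkIn G P y z → WalkIn G P x z

-- H is a minor of G: there is a model of H in G given by disjoint, nonempty,
-- connected branch sets  f⁻¹(just i)  (vertices with f x ≡ nothing are deleted),
-- with an edge of G between the branch sets of any two adjacent vertices of H.
IsMinor : Graph → Graph → Set
IsMinor H G =
  Σ (Fin (n G) → Maybe (Fin (n H))) λ f →
    (∀ i → ∃[ x ] (f x ≡ just i)) ×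
    (∀ i x y → f x ≡ just i → f y ≡ just i → WalkIn G (λ z → f z ≡ just i) x y) ×
    (∀ i j → Adj H i j → ∃[ x ] ∃[ y ] (f x ≡ just i × f y ≡ just j × Adj G x y))

-- Triskelion: vertices 0,1,2 = v1,v2,v3 (triangle); 3,4,5 = w1,w2,w3 with vᵢwᵢ.
triE : Fin 6 → Fin 6 → Bool
triE zero (suc zero) = true
triE (suc zero) (suc (suc zero)) = true
triE zero (suc (suc zero)) = true
triE zero (suc (suc (suc zero))) = true
triE (suc zero) (suc (suc (suc (suc zero)))) = true
triE (suc (suc zero)) (suc (suc (suc (suc (suc zero))))) = true
triE _ _ = false

triAdj : Fin 6 → Fin 6 → Bool
triAdj x y = triE x y ∨ triE y x

triIrrefl : ∀ x → triAdj x x ≡ false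
triIrrefl zero = refl
triIrrefl (suc zero) = refl
triIrrefl (suc (suc zero)) = refl
triIrrefl (suc (suc (suc zero))) = refl
triIrrefl (suc (suc (suc (suc zero)))) = refl
triIrrefl (suc (suc (suc (suc (suc zero))))) = refl

triskelion : Graph
triskelion = record
  { n = 6
  ; adj = triAdj
  ; sym = λ x y → ∨-comm (triE x y) (triE y x)
  ; irrefl = triIrrefl
  }

module Submission where

-- The triskelion is a minor of any cycle x₀ x₁ x₂ … with distinct "pendants"
-- a₀ a₁ a₂ off the cycle, xᵢ adjacent to aᵢ (contract the cycle minus x₀, x₁).
-- Oddness gives each vertex a neighbour outside any even list of its
-- neighbours; irreducibility forbids "twins" (vertices with equal
-- neighbourhoods apart from each other).  Two leaves at one vertex are twins,
-- so a path grown through non-leaves closes a cycle.  In a shortest cycle: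
-- for a triangle, the outer neighbourhoods of its vertices are odd sets, no
-- two equal singletons (twins), so a three-set Hall argument gives pendants;
-- for a longer cycle, shortness forbids chords, so x₀ x₁ x₂ have outer
-- neighbours, and a coincidence among them closes a smaller triangle or
-- square, except in a square, where a vertex distinguishing x₀ from x₂ helps.

open import Defs
open import Data.Nat using (ℕ; zero; suc; _+_; _%_; _≤_; _<_; s≤s; z≤n)
open import Data.Nat.Properties using (≤-trans; ≤-reflexive; <-irrefl; +-suc; +-comm; m≤m+n)
open import Data.Nat.Induction using (<-rec)
open import Data.Fin using (Fin; zero; suc; fromℕ<)
open import Data.Fin.Properties using (_≟_; any?; <-cmp)
open import Data.Bool using (Bool; true; false; if_then_else_)
import Data.Bool.Properties as Bool
open import Data.Maybe using (Maybe; just; nothing)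
open import Data.List using (List; []; _∷_; length; map; filter; allFin; _++_; _∷ʳ_)
open import Data.List.Properties using (length-filter; length-tabulate; length-++)
open import Data.Nat.ListAction using (sum)
open import Data.List.Membership.Propositional using (_∈_; _∉_)
open import Data.List.Membership.Propositional.Properties using (∈-filter⁺; ∈-filter⁻; ∈-allFin; ∈-++⁺ˡ; ∈-++⁺ʳ; ∈-∃++)
open import Data.List.Membership.Propositional.Properties.WithK using (unique∧set⇒bag)
open import Data.List.Relation.Binary.BagAndSetEquality using (∼bag⇒↭)
open import Data.List.Relation.Binary.Permutation.Propositional.Properties using (↭-length)
open import Data.List.Relation.Unary.Any using (here; there)
open import Data.List.Relation.Unary.All using ([]; _∷_; lookup)
import Data.List.Relation.Unary.All.Properties as All
open import Data.List.Relation.Unary.AllPairs using ([]; _∷_)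
import Data.List.Relation.Unary.AllPairs as AllPairs
open import Data.List.Relation.Unary.Linked using (Linked; [-]; _∷_)
import Data.List.Relation.Unary.Linked as Linked
open import Data.List.Relation.Unary.Unique.Propositional using (Unique)
open import Data.List.Relation.Unary.Unique.Propositional.Properties using (Unique[x∷xs]⇒x∉xs; filter⁺; allFin⁺)
import Data.List.Relation.Unary.Unique.Propositional.Properties as Unique
open import Data.Product using (Σ; ∃; ∃-syntax; _×_; _,_; proj₁; proj₂)
open import Data.Sum using (_⊎_; inj₁; inj₂)
open import Data.Empty using (⊥; ⊥-elim)
open import Function.Base using (id; _∘_)
open import Function.Bundles using (_⇔_; mk⇔; Equivalence)
open import Relation.Nullary using (¬_; Dec; yes; no; ¬?; contradiction)
open import Relation.Nullary.Decidable using (_×-dec_; decidable-stable)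
open import Relation.Binary.Definitions using (DecidableEquality; tri<; tri≈; tri>)
open import Relation.Binary.PropositionalEquality using (_≡_; _≢_; refl; cong; trans; subst; ≢-sym) renaming (sym to ≡-sym)

module _ {A : Set} where

  unique-length : {xs ys : List A} → Unique xs → Unique ys → (∀ {z} → z ∈ xs ⇔ z ∈ ys) → length xs ≡ length ys
  unique-length uxs uys same = ↭-length (∼bag⇒↭ (unique∧set⇒bag uxs uys same))

  sum-indicator : (b : A → Bool) (xs : List A) →
                  sum (map (λ y → if b y then 1 else 0) xs) ≡ length (filter (λ y → b y Bool.≟ true) xs)
  sum-indicator b [] = refl
  sum-indicator b (x ∷ xs) with b x
  ... | true  = cong suc (sum-indicator b xs)
  ... | false = sum-indicator b xs

  ∉⇒≢ : ∀ {a z} {xs : List A} → a ∉ xs → z ∈ xs → a ≢ z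
  ∉⇒≢ a∉ z∈ refl = a∉ z∈

  unique-cons : ∀ {x} {xs : List A} → x ∉ xs → Unique xs → Unique (x ∷ xs)
  unique-cons x∉ uxs = All.¬Any⇒All¬ _ x∉ ∷ uxs

  unique-snoc : ∀ {xs : List A} {y} → Unique xs → y ∉ xs → Unique (xs ∷ʳ y)
  unique-snoc uxs y∉ = Unique.++⁺ uxs ([] ∷ []) λ { (y∈ , here refl) → y∉ y∈ }

  unique-cut : ∀ (xs : List A) {y ys} → Unique (xs ++ y ∷ ys) → Unique (xs ∷ʳ y)
  unique-cut [] _ = [] ∷ []
  unique-cut (x ∷ xs) (x∉ ∷ u) =
    All.∷ʳ⁺ (All.++⁻ˡ xs x∉) (lookup x∉ (∈-++⁺ʳ xs (here refl))) ∷ unique-cut xs u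

  cut-shorter : ∀ (xs : List A) y b ys → length (xs ∷ʳ y) < length (xs ++ y ∷ b ∷ ys)
  cut-shorter [] y b ys = s≤s (s≤s z≤n)
  cut-shorter (x ∷ xs) y b ys = s≤s (cut-shorter xs y b ys)

  ∈-rotate : ∀ {z x} {xs : List A} → z ∈ x ∷ xs → z ∈ xs ∷ʳ x
  ∈-rotate {xs = xs} (here z≡x) = ∈-++⁺ʳ xs (here z≡x)
  ∈-rotate (there z∈xs) = ∈-++⁺ˡ z∈xs

  lastOf : A → List A → A
  lastOf x [] = x
  lastOf x (y ∷ ys) = lastOf y ys

  lastOf-∈ : ∀ x xs → lastOf x xs ∈ x ∷ xs
  lastOf-∈ x [] = here refl
  lastOf-∈ x (y ∷ ys) = there (lastOf-∈ y ys)

  lastOf-snoc : ∀ x xs y → lastOf x (xs ∷ʳ y) ≡ y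
  lastOf-snoc x [] y = refl
  lastOf-snoc x (x′ ∷ xs) y = lastOf-snoc x′ xs y

  linked-snoc : ∀ {R : A → A → Set} {x xs y} → Linked R (x ∷ xs) → R (lastOf x xs) y → Linked R ((x ∷ xs) ∷ʳ y)
  linked-snoc [-] xy = xy ∷ [-]
  linked-snoc (xx′ ∷ lk) xy = xx′ ∷ linked-snoc lk xy

  linked-cut : ∀ {R : A → A → Set} xs {y ys} → Linked R (xs ++ y ∷ ys) → Linked R (xs ∷ʳ y)
  linked-cut [] _ = [-]
  linked-cut (x ∷ []) (xy ∷ _) = xy ∷ [-]
  linked-cut (x ∷ x′ ∷ xs) (xx′ ∷ lk) = xx′ ∷ linked-cut (x′ ∷ xs) lk

  split-snoc : List A → A → A × List A
  split-snoc [] y = y , []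
  split-snoc (x ∷ xs) y = x , xs ∷ʳ y

  split-snoc-≡ : ∀ xs y → proj₁ (split-snoc xs y) ∷ proj₂ (split-snoc xs y) ≡ xs ∷ʳ y
  split-snoc-≡ [] y = refl
  split-snoc-≡ (x ∷ xs) y = refl

  split-snoc-last : ∀ xs y → lastOf (proj₁ (split-snoc xs y)) (proj₂ (split-snoc xs y)) ≡ y
  split-snoc-last [] y = refl
  split-snoc-last (x ∷ xs) y = lastOf-snoc x xs y

  split-snoc-length : ∀ xs y → length (proj₂ (split-snoc xs y)) ≡ length xs
  split-snoc-length [] y = refl
  split-snoc-length (x ∷ xs) y = trans (length-++ xs) (+-comm (length xs) 1)

module _ {A : Set} where

  data Shape (N : A → Set) : Set where
    single : ∀ s → N s → (∀ {y} → N y → y ≡ s) → Shape N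
    spread : (∀ x y → ∃[ z ] (N z × z ≢ x × z ≢ y)) → Shape N

  NotSameSingleton : (N M : A → Set) → Set
  NotSameSingleton N M = ∀ {s} → N s → M s → (∀ {y} → N y → y ≡ s) → (∀ {y} → M y → y ≡ s) → ⊥

  singles-differ : ∀ {N M s t} → NotSameSingleton N M → N s → (∀ {y} → N y → y ≡ s) →
                   M t → (∀ {y} → M y → y ≡ t) → s ≢ t
  singles-differ nss ns onlyS mt onlyT refl = nss ns mt onlyS onlyT

  three-avoid : DecidableEquality A → ∀ {N : A → Set} {a b c} → N a → N b → N c → a ≢ b → a ≢ c → b ≢ c →
                ∀ x y → ∃[ z ] (N z × z ≢ x × z ≢ y)
  three-avoid _≟_ {a = a} {b} na nb nc a≢b a≢c b≢c x y with a ≟ x | a ≟ y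
  ... | no a≢x | no a≢y = a , na , a≢x , a≢y
  ... | yes refl | _ with b ≟ y
  ...   | yes refl = _ , nc , (λ c≡a → a≢c (≡-sym c≡a)) , (λ c≡b → b≢c (≡-sym c≡b))
  ...   | no b≢y = b , nb , (λ b≡a → a≢b (≡-sym b≡a)) , b≢y
  three-avoid _≟_ {a = a} {b} na nb nc a≢b a≢c b≢c x y | no a≢x | yes refl with b ≟ x
  ...   | yes refl = _ , nc , (λ c≡b → b≢c (≡-sym c≡b)) , (λ c≡a → a≢c (≡-sym c≡a))
  ...   | no b≢x = b , nb , b≢x , (λ b≡a → a≢b (≡-sym b≡a))

  -- Hall's theorem for three sets, each a singleton or avoiding any two
  -- elements: distinct representatives exist unless two are the same
  -- singleton.  (The element of A serves as a dummy when all three are large.)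
  distinct-representatives :
    A → ∀ {N₁ N₂ N₃} → Shape N₁ → Shape N₂ → Shape N₃ →
    NotSameSingleton N₁ N₂ → NotSameSingleton N₁ N₃ → NotSameSingleton N₂ N₃ →
    ∃[ a ] ∃[ b ] ∃[ c ] (N₁ a × N₂ b × N₃ c × a ≢ b × a ≢ c × b ≢ c)
  distinct-representatives _ (single a na onlyA) (single b nb onlyB) (single c nc onlyC) n₁₂ n₁₃ n₂₃ =
    a , b , c , na , nb , nc , singles-differ n₁₂ na onlyA nb onlyB , singles-differ n₁₃ na onlyA nc onlyC ,
    singles-differ n₂₃ nb onlyB nc onlyC
  distinct-representatives _ (single a na onlyA) (single b nb onlyB) (spread N₃) n₁₂ _ _ =
    let c , nc , c≢a , c≢b = N₃ a b in
    a , b , c , na , nb , nc , singles-differ n₁₂ na onlyA nb onlyB , ≢-sym c≢a , ≢-sym c≢b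
  distinct-representatives _ (single a na onlyA) (spread N₂) (single c nc onlyC) _ n₁₃ _ =
    let b , nb , b≢a , b≢c = N₂ a c in
    a , b , c , na , nb , nc , ≢-sym b≢a , singles-differ n₁₃ na onlyA nc onlyC , b≢c
  distinct-representatives _ (spread N₁) (single b nb onlyB) (single c nc onlyC) _ _ n₂₃ =
    let a , na , a≢b , a≢c = N₁ b c in
    a , b , c , na , nb , nc , a≢b , a≢c , singles-differ n₂₃ nb onlyB nc onlyC
  distinct-representatives _ (single a na _) (spread N₂) (spread N₃) _ _ _ =
    let b , nb , b≢a , _ = N₂ a a ; c , nc , c≢a , c≢b = N₃ a b in
    a , b , c , na , nb , nc , ≢-sym b≢a , ≢-sym c≢a , ≢-sym c≢b
  distinct-representatives _ (spread N₁) (single b nb _) (spread N₃) _ _ _ =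
    let a , na , a≢b , _ = N₁ b b ; c , nc , c≢a , c≢b = N₃ a b in
    a , b , c , na , nb , nc , a≢b , ≢-sym c≢a , ≢-sym c≢b
  distinct-representatives _ (spread N₁) (spread N₂) (single c nc _) _ _ _ =
    let a , na , a≢c , _ = N₁ c c ; b , nb , b≢a , b≢c = N₂ a c in
    a , b , c , na , nb , nc , ≢-sym b≢a , a≢c , b≢c
  distinct-representatives x (spread N₁) (spread N₂) (spread N₃) _ _ _ =
    let a , na , _ = N₁ x x ; b , nb , b≢a , _ = N₂ a a ; c , nc , c≢a , c≢b = N₃ a b in
    a , b , c , na , nb , nc , ≢-sym b≢a , ≢-sym c≢a , ≢-sym c≢b

map-walk : ∀ {G : Graph} {P Q : Fin (n G) → Set} {x y} → (∀ {z} → P z → Q z) → WalkIn G P x y → WalkIn G Q x y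
map-walk f (here p) = here (f p)
map-walk f (step p a w) = step (f p) a (map-walk f w)

record Model (H G : Graph) : Set₁ where
  field
    Branch    : Fin (n H) → Fin (n G) → Set
    branch?   : ∀ i z → Dec (Branch i z)
    disjoint  : ∀ {i j z} → Branch i z → Branch j z → i ≡ j
    nonempty  : ∀ i → ∃ (Branch i)
    connected : ∀ i {x y} → Branch i x → Branch i y → WalkIn G (Branch i) x y
    touching  : ∀ i j → Adj H i j → ∃[ x ] ∃[ y ] (Branch i x × Branch j y × Adj G x y)

disjoint-from-ordered : ∀ {k} {A : Set} (B : Fin k → A → Set) →
  (∀ {i j z} → j Data.Fin.< i → B i z → ¬ B j z) → ∀ {i j z} → B i z → B j z → i ≡ j
disjoint-from-ordered B separated {i} {j} bi bj with <-cmp i j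
... | tri< i<j _ _ = ⊥-elim (separated i<j bj bi)
... | tri≈ _ i≡j _ = i≡j
... | tri> _ _ j<i = ⊥-elim (separated j<i bi bj)

model⇒minor : ∀ {H G} → Model H G → IsMinor H G
model⇒minor {H} {G} M =
  label , (λ i → let x , bx = nonempty i in x , label-complete bx)
  , (λ i x y lx ly → map-walk label-complete (connected i (label-sound lx) (label-sound ly)))
  , λ i j ij → let x , y , bx , by , xy = touching i j ij in x , y , label-complete bx , label-complete by , xy
  where
  open Model M
  label : Fin (n G) → Maybe (Fin (n H))
  label z with any? (λ i → branch? i z)
  ... | yes (i , _) = just i
  ... | no _ = nothing

  label-sound : ∀ {i z} → label z ≡ just i → Branch i z
  label-sound {i} {z} eq with any? (λ i → branch? i z)
  label-sound refl | yes (i , bi) = bi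

  label-complete : ∀ {i z} → Branch i z → label z ≡ just i
  label-complete {i} {z} bi with any? (λ i → branch? i z)
  ... | yes (j , bj) = cong just (disjoint bj bi)
  ... | no none = ⊥-elim (none (i , bi))

pattern v₁ = zero
pattern v₂ = suc zero
pattern v₃ = suc (suc zero)
pattern w₁ = suc (suc (suc zero))
pattern w₂ = suc (suc (suc (suc zero)))
pattern w₃ = suc (suc (suc (suc (suc zero))))

data TriEdge : Fin 6 → Fin 6 → Set where
  v₁v₂ : TriEdge v₁ v₂
  v₂v₃ : TriEdge v₂ v₃
  v₁v₃ : TriEdge v₁ v₃
  v₁w₁ : TriEdge v₁ w₁
  v₂w₂ : TriEdge v₂ w₂
  v₃w₃ : TriEdge v₃ w₃

triE-edge : ∀ i j → triE i j ≡ true → TriEdge i j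
triE-edge v₁ v₂ _ = v₁v₂
triE-edge v₂ v₃ _ = v₂v₃
triE-edge v₁ v₃ _ = v₁v₃
triE-edge v₁ w₁ _ = v₁w₁
triE-edge v₂ w₂ _ = v₂w₂
triE-edge v₃ w₃ _ = v₃w₃
triE-edge v₁ v₁ ()
triE-edge v₁ (suc (suc (suc (suc _)))) ()
triE-edge v₂ v₁ ()
triE-edge v₂ v₂ ()
triE-edge v₂ w₁ ()
triE-edge v₂ w₃ ()
triE-edge v₃ v₁ ()
triE-edge v₃ v₂ ()
triE-edge v₃ v₃ ()
triE-edge v₃ w₁ ()
triE-edge v₃ w₂ ()
triE-edge (suc (suc (suc _))) _ ()

triskelion-edge : ∀ i j → Adj triskelion i j → TriEdge i j ⊎ TriEdge j i
triskelion-edge i j e with triE i j in eij | triE j i in eji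
... | true  | _     = inj₁ (triE-edge i j eij)
... | false | true  = inj₂ (triE-edge j i eji)
triskelion-edge i j () | false | false

module InGraph (G : Graph) where

  V : Set
  V = Fin (n G)

  open import Data.List.Membership.DecPropositional (_≟_ {n G}) using (_∈?_)

  adj? : ∀ x y → Dec (Adj G x y)
  adj? x y = adj G x y Bool.≟ true

  adj-sym : ∀ {x y} → Adj G x y → Adj G y x
  adj-sym {x} {y} xy = trans (Graph.sym G y x) xy

  adj-≢ : ∀ {x y} → Adj G x y → x ≢ y
  adj-≢ {x} xy refl with trans (≡-sym (Graph.irrefl G x)) xy
  ... | ()

  degree-length : ∀ x (L : List V) → Unique L → (∀ {y} → y ∈ L ⇔ Adj G x y) → degree G x ≡ length L
  degree-length x L uL nbrs = trans (sum-indicator (adj G x) (allFin (n G)))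
    (unique-length (filter⁺ (adj? x) {allFin (n G)} (allFin⁺ (n G))) uL
      (mk⇔ (λ y∈ → Equivalence.from nbrs (proj₂ (∈-filter⁻ (adj? x) {xs = allFin (n G)} y∈)))
           (λ y∈L → ∈-filter⁺ (adj? x) (∈-allFin _) (Equivalence.to nbrs y∈L))))

  unique-length≤ : (L : List V) → Unique L → length L ≤ n G
  unique-length≤ L uL = subst (_≤ n G) (≡-sym (unique-length uL (filter⁺ ∈L? {allFin (n G)} (allFin⁺ (n G)))
       (mk⇔ (λ y∈L → ∈-filter⁺ ∈L? (∈-allFin _) y∈L) (λ y∈ → proj₂ (∈-filter⁻ ∈L? {xs = allFin (n G)} y∈)))))
       (≤-trans (length-filter ∈L? (allFin (n G))) (≤-reflexive (length-tabulate id)))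
    where
    ∈L? : ∀ y → Dec (y ∈ L)
    ∈L? y = y ∈? L

  neighbour-outside : IsOdd G → ∀ x (L : List V) → Unique L → (∀ {y} → y ∈ L → Adj G x y) →
                      length L % 2 ≡ 0 → ∃[ y ] (Adj G x y × y ∉ L)
  neighbour-outside odd x L uL L⊆N even with any? (λ y → adj? x y ×-dec ¬? (y ∈? L))
  ... | yes found = found
  ... | no none = contradiction (trans (≡-sym parity) even) λ ()
    where
    N⊆L : ∀ {y} → Adj G x y → y ∈ L
    N⊆L {y} xy = decidable-stable (y ∈? L) λ y∉L → none (y , xy , y∉L)
    parity : length L % 2 ≡ 1
    parity = trans (cong (_% 2) (≡-sym (degree-length x L uL (mk⇔ L⊆N N⊆L)))) (odd x)

  module _ {P : V → Set} where
    walk-start : ∀ {x y} → WalkIn G P x y → P x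
    walk-start (here p) = p
    walk-start (step p _ _) = p

    _++ʷ_ : ∀ {x y z} → WalkIn G P x y → WalkIn G P y z → WalkIn G P x z
    here _ ++ʷ w′ = w′
    step p xy w ++ʷ w′ = step p xy (w ++ʷ w′)

    reverse-walk : ∀ {x y} → WalkIn G P x y → WalkIn G P y x
    reverse-walk (here p) = here p
    reverse-walk (step p xy w) = reverse-walk w ++ʷ step (walk-start w) (adj-sym xy) (here p)

  walk-from-head : ∀ {x xs y} → Linked (Adj G) (x ∷ xs) → y ∈ x ∷ xs → WalkIn G (_∈ x ∷ xs) x y
  walk-from-head _ (here refl) = here (here refl)
  walk-from-head (xx′ ∷ lk) (there y∈) = step (here refl) xx′ (map-walk there (walk-from-head lk y∈))

  path-connected : ∀ {x xs y z} → Linked (Adj G) (x ∷ xs) → y ∈ x ∷ xs → z ∈ x ∷ xs → WalkIn G (_∈ x ∷ xs) y z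
  path-connected lk y∈ z∈ = reverse-walk (walk-from-head lk y∈) ++ʷ walk-from-head lk z∈

  record Cycle : Set where
    constructor cycle
    field
      x₀ x₁ x₂ : V
      rest     : List V
      linked   : Linked (Adj G) (x₀ ∷ x₁ ∷ x₂ ∷ rest)
      unique   : Unique (x₀ ∷ x₁ ∷ x₂ ∷ rest)
      closes   : Adj G (lastOf x₂ rest) x₀

    vertices : List V
    vertices = x₀ ∷ x₁ ∷ x₂ ∷ rest

    Outer : V → V → Set
    Outer v y = Adj G v y × y ∉ vertices

  open Cycle public

  -- The length of a cycle, minus three.
  size : Cycle → ℕ
  size C = length (rest C)

  rotate : Cycle → Cycle
  rotate C .x₀ = x₁ C
  rotate C .x₁ = x₂ C
  rotate C .x₂ = proj₁ (split-snoc (rest C) (x₀ C))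
  rotate C .rest = proj₂ (split-snoc (rest C) (x₀ C))
  rotate C .linked = subst (λ L → Linked (Adj G) (x₁ C ∷ x₂ C ∷ L)) (≡-sym (split-snoc-≡ (rest C) (x₀ C)))
    (linked-snoc (Linked.tail (linked C)) (closes C))
  rotate C .unique = subst (λ L → Unique (x₁ C ∷ x₂ C ∷ L)) (≡-sym (split-snoc-≡ (rest C) (x₀ C)))
    (unique-snoc (AllPairs.tail (unique C)) (Unique[x∷xs]⇒x∉xs (unique C)))
  rotate C .closes = subst (λ v → Adj G v (x₁ C)) (≡-sym (split-snoc-last (rest C) (x₀ C))) (Linked.head (linked C))

  rotate-size : ∀ C → size (rotate C) ≡ size C
  rotate-size C = split-snoc-length (rest C) (x₀ C)

  rotate-⊇ : ∀ C {z} → z ∈ vertices C → z ∈ vertices (rotate C)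
  rotate-⊇ C z∈ = subst (λ L → _ ∈ x₁ C ∷ x₂ C ∷ L) (≡-sym (split-snoc-≡ (rest C) (x₀ C))) (∈-rotate z∈)

  close-at : ∀ {x₀ x₁ x₂ P y} → Linked (Adj G) (x₀ ∷ x₁ ∷ x₂ ∷ P) → Unique (x₀ ∷ x₁ ∷ x₂ ∷ P) →
             y ∈ x₂ ∷ P → Adj G y x₀ → Σ Cycle λ D → y ≢ lastOf x₂ P → size D < length P
  close-at {x₀} {x₁} {P = P} lk uq (here refl) yx₀ =
    cycle _ _ _ [] (linked-cut (x₀ ∷ x₁ ∷ []) lk) (unique-cut (x₀ ∷ x₁ ∷ []) uq) yx₀ , shorter P
    where
    shorter : ∀ P → _ ≢ lastOf _ P → 0 < length P
    shorter [] y≢ = ⊥-elim (y≢ refl)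
    shorter (_ ∷ _) _ = s≤s z≤n
  close-at {x₀} {x₁} {x₂} lk uq (there y∈P) yx₀ with ∈-∃++ y∈P
  ... | A , B , refl =
    cycle x₀ x₁ x₂ (A ∷ʳ _) (linked-cut (x₀ ∷ x₁ ∷ x₂ ∷ A) lk) (unique-cut (x₀ ∷ x₁ ∷ x₂ ∷ A) uq)
          (subst (λ v → Adj G v x₀) (≡-sym (lastOf-snoc x₂ A _)) yx₀) , shorter B
    where
    shorter : ∀ B → _ ≢ lastOf x₂ (A ++ _ ∷ B) → length (A ∷ʳ _) < length (A ++ _ ∷ B)
    shorter [] y≢ = ⊥-elim (y≢ (≡-sym (lastOf-snoc x₂ A _)))
    shorter (b ∷ B) _ = cut-shorter A _ b B

  triangle-cycle : ∀ {x y z} → Adj G x y → Adj G y z → Adj G z x → x ≢ y → x ≢ z → y ≢ z → Cycle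
  triangle-cycle xy yz zx x≢y x≢z y≢z =
    cycle _ _ _ [] (xy ∷ yz ∷ [-]) ((x≢y ∷ x≢z ∷ []) ∷ (y≢z ∷ []) ∷ [] ∷ []) zx

  square-cycle : ∀ {w x y z} → Adj G w x → Adj G x y → Adj G y z → Adj G z w →
                 w ≢ x → w ≢ y → w ≢ z → x ≢ y → x ≢ z → y ≢ z → Cycle
  square-cycle wx xy yz zw w≢x w≢y w≢z x≢y x≢z y≢z =
    cycle _ _ _ (_ ∷ []) (wx ∷ xy ∷ yz ∷ [-])
      ((w≢x ∷ w≢y ∷ w≢z ∷ []) ∷ (x≢y ∷ x≢z ∷ []) ∷ (y≢z ∷ []) ∷ [] ∷ []) zw

  outer-triangle : ∀ C {u v a} → u ∈ vertices C → v ∈ vertices C → Adj G u v → Outer C u a → Outer C v a → Cycle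
  outer-triangle C u∈ v∈ uv ua va =
    triangle-cycle uv (proj₁ va) (adj-sym (proj₁ ua)) (adj-≢ uv) (≢-sym (∉⇒≢ (proj₂ ua) u∈)) (≢-sym (∉⇒≢ (proj₂ ua) v∈))

  record Pendants (C : Cycle) : Set where
    constructor pendants
    field
      a₀ a₁ a₂ : V
      outer₀   : Outer C (x₀ C) a₀
      outer₁   : Outer C (x₁ C) a₁
      outer₂   : Outer C (x₂ C) a₂
      a₀≢a₁    : a₀ ≢ a₁
      a₀≢a₂    : a₀ ≢ a₂
      a₁≢a₂    : a₁ ≢ a₂

  pendant-model : (C : Cycle) → Pendants C → Model triskelion G
  pendant-model (cycle x₀ x₁ x₂ rest lk uq cl) (pendants a₀ a₁ a₂ (x₀a₀ , a₀∉) (x₁a₁ , a₁∉) (x₂a₂ , a₂∉) a₀≢a₁ a₀≢a₂ a₁≢a₂) =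
    record
      { Branch = Branch ; branch? = branch? ; disjoint = disjoint-from-ordered Branch separated
      ; nonempty = nonempty ; connected = connected ; touching = touching }
    where
    T : List V
    T = x₂ ∷ rest

    Branch : Fin 6 → V → Set
    Branch v₁ z = z ≡ x₀
    Branch v₂ z = z ≡ x₁
    Branch v₃ z = z ∈ T
    Branch w₁ z = z ≡ a₀
    Branch w₂ z = z ≡ a₁
    Branch w₃ z = z ≡ a₂

    branch? : ∀ i z → Dec (Branch i z)
    branch? v₁ z = z ≟ x₀
    branch? v₂ z = z ≟ x₁
    branch? v₃ z = z ∈? T
    branch? w₁ z = z ≟ a₀
    branch? w₂ z = z ≟ a₁
    branch? w₃ z = z ≟ a₂

    x₀≢x₁ : x₀ ≢ x₁
    x₀≢x₁ e = Unique[x∷xs]⇒x∉xs uq (here e)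

    x₀∉T : x₀ ∉ T
    x₀∉T x₀∈ = Unique[x∷xs]⇒x∉xs uq (there x₀∈)

    x₁∉T : x₁ ∉ T
    x₁∉T = Unique[x∷xs]⇒x∉xs (AllPairs.tail uq)

    separated : ∀ {i j z} → j Data.Fin.< i → Branch i z → ¬ Branch j z
    separated {v₁} ()
    separated {v₂} {suc _} (s≤s ())
    separated {v₃} {suc (suc _)} (s≤s (s≤s ()))
    separated {w₁} {suc (suc (suc _))} (s≤s (s≤s (s≤s ())))
    separated {w₂} {suc (suc (suc (suc _)))} (s≤s (s≤s (s≤s (s≤s ()))))
    separated {w₃} {suc (suc (suc (suc (suc _))))} (s≤s (s≤s (s≤s (s≤s (s≤s ())))))
    separated {v₂} {v₁} _ refl x₁≡x₀ = x₀≢x₁ (≡-sym x₁≡x₀)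
    separated {v₃} {v₁} _ x₀∈T refl = x₀∉T x₀∈T
    separated {v₃} {v₂} _ x₁∈T refl = x₁∉T x₁∈T
    separated {w₁} {v₁} _ refl e = a₀∉ (here e)
    separated {w₁} {v₂} _ refl e = a₀∉ (there (here e))
    separated {w₁} {v₃} _ refl e = a₀∉ (there (there e))
    separated {w₂} {v₁} _ refl e = a₁∉ (here e)
    separated {w₂} {v₂} _ refl e = a₁∉ (there (here e))
    separated {w₂} {v₃} _ refl e = a₁∉ (there (there e))
    separated {w₂} {w₁} _ refl e = a₀≢a₁ (≡-sym e)
    separated {w₃} {v₁} _ refl e = a₂∉ (here e)
    separated {w₃} {v₂} _ refl e = a₂∉ (there (here e))
    separated {w₃} {v₃} _ refl e = a₂∉ (there (there e))
    separated {w₃} {w₁} _ refl e = a₀≢a₂ (≡-sym e)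
    separated {w₃} {w₂} _ refl e = a₁≢a₂ (≡-sym e)

    nonempty : ∀ i → ∃ (Branch i)
    nonempty v₁ = x₀ , refl
    nonempty v₂ = x₁ , refl
    nonempty v₃ = x₂ , here refl
    nonempty w₁ = a₀ , refl
    nonempty w₂ = a₁ , refl
    nonempty w₃ = a₂ , refl

    point : ∀ {c x y} → x ≡ c → y ≡ c → WalkIn G (_≡ c) x y
    point refl refl = here refl

    connected : ∀ i {x y} → Branch i x → Branch i y → WalkIn G (Branch i) x y
    connected v₁ = point
    connected v₂ = point
    connected v₃ = path-connected (Linked.tail (Linked.tail lk))
    connected w₁ = point
    connected w₂ = point
    connected w₃ = point

    edge : ∀ {i j} → TriEdge i j → ∃[ x ] ∃[ y ] (Branch i x × Branch j y × Adj G x y)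
    edge v₁v₂ = x₀ , x₁ , refl , refl , Linked.head lk
    edge v₂v₃ = x₁ , x₂ , refl , here refl , Linked.head (Linked.tail lk)
    edge v₁v₃ = x₀ , lastOf x₂ rest , refl , lastOf-∈ x₂ rest , adj-sym cl
    edge v₁w₁ = x₀ , a₀ , refl , refl , x₀a₀
    edge v₂w₂ = x₁ , a₁ , refl , refl , x₁a₁
    edge v₃w₃ = x₂ , a₂ , here refl , refl , x₂a₂

    touching : ∀ i j → Adj triskelion i j → ∃[ x ] ∃[ y ] (Branch i x × Branch j y × Adj G x y)
    touching i j ij with triskelion-edge i j ij
    ... | inj₁ e = edge e
    ... | inj₂ e = let x , y , bx , by , xy = edge e in y , x , by , bx , adj-sym xy

  pendants⇒triskelion : (C : Cycle) → Pendants C → IsMinor triskelion G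
  pendants⇒triskelion C p = model⇒minor (pendant-model C p)


module Irreducible (G : Graph) (irreducibly-odd : IrreduciblyOdd G) where
  open InGraph G
  open import Data.List.Membership.DecPropositional (_≟_ {n G}) using (_∈?_)

  odd : IsOdd G
  odd = proj₁ irreducibly-odd

  distinguish : ∀ u v → u ≢ v →
    ∃[ w ] (w ≢ u × w ≢ v × ((Adj G w u × ¬ Adj G w v) ⊎ (¬ Adj G w u × Adj G w v)))
  distinguish = proj₂ irreducibly-odd

  no-twins : ∀ {u v} → u ≢ v → (∀ {z} → Adj G u z → z ≢ v → Adj G v z) →
             (∀ {z} → Adj G v z → z ≢ u → Adj G u z) → ⊥
  no-twins u≢v u⊆v v⊆u with distinguish _ _ u≢v
  ... | w , w≢u , w≢v , inj₁ (wu , ¬wv) = ¬wv (adj-sym (u⊆v (adj-sym wu) w≢v))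
  ... | w , w≢u , w≢v , inj₂ (¬wu , wv) = ¬wu (adj-sym (v⊆u (adj-sym wv) w≢u))

  Branching : V → Set
  Branching x = ∃[ y ] ∃[ z ] (Adj G x y × Adj G x z × y ≢ z)

  branching? : ∀ x → Dec (Branching x)
  branching? x = any? λ y → any? λ z → adj? x y ×-dec adj? x z ×-dec ¬? (y ≟ z)

  leaf-neighbour : ∀ {x y z} → ¬ Branching x → Adj G x y → Adj G x z → z ≡ y
  leaf-neighbour {y = y} {z} leaf xy xz = decidable-stable (z ≟ y) λ z≢y → leaf (z , y , xz , xy , z≢y)

  -- Two leaves hanging at the same vertex would be twins.
  leaves-coincide : ∀ {x u v} → ¬ Branching u → ¬ Branching v → Adj G x u → Adj G x v → u ≡ v
  leaves-coincide leafU leafV xu xv = decidable-stable (_ ≟ _) λ u≢v →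
    no-twins u≢v (λ uz _ → subst (Adj G _) (≡-sym (leaf-neighbour leafU (adj-sym xu) uz)) (adj-sym xv))
                 (λ vz _ → subst (Adj G _) (≡-sym (leaf-neighbour leafV (adj-sym xv) vz)) (adj-sym xu))

  -- Some vertex is branching: otherwise a vertex and its neighbour would be twins.
  some-branching : Fin (n G) → ∃ Branching
  some-branching x with neighbour-outside odd x [] [] (λ ()) refl
  ... | y , xy , _ with branching? x | branching? y
  ...   | yes bx | _ = x , bx
  ...   | no _ | yes by = y , by
  ...   | no leafX | no leafY = ⊥-elim (no-twins (adj-≢ xy)
          (λ xz z≢y → ⊥-elim (z≢y (leaf-neighbour leafX xy xz)))
          (λ yz z≢x → ⊥-elim (z≢x (leaf-neighbour leafY (adj-sym xy) yz))))

  -- A branching vertex has two distinct branching neighbours: it has a third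
  -- neighbour by oddness, and at most one of its neighbours is a leaf.
  branching-neighbours : ∀ {x} → Branching x →
    ∃[ y ] ∃[ z ] (Adj G x y × Adj G x z × y ≢ z × Branching y × Branching z)
  branching-neighbours {x} (y , z , xy , xz , y≢z)
    with neighbour-outside odd x (y ∷ z ∷ []) (unique-cons (λ { (here y≡z) → y≢z y≡z }) (unique-cons (λ ()) []))
           (λ { (here refl) → xy ; (there (here refl)) → xz }) refl
  ... | w , xw , w∉ with branching? y | branching? z | branching? w
  ... | yes by | yes bz | _ = y , z , xy , xz , y≢z , by , bz
  ... | yes by | no _ | yes bw = y , w , xy , xw , (λ y≡w → w∉ (here (≡-sym y≡w))) , by , bw
  ... | no _ | yes bz | yes bw = z , w , xz , xw , (λ z≡w → w∉ (there (here (≡-sym z≡w)))) , bz , bw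
  ... | yes _ | no leafZ | no leafW = ⊥-elim (w∉ (there (here (leaves-coincide leafW leafZ xw xz))))
  ... | no leafY | yes _ | no leafW = ⊥-elim (w∉ (here (leaves-coincide leafW leafY xw xy)))
  ... | no leafY | no leafZ | _ = ⊥-elim (y≢z (leaves-coincide leafY leafZ xy xz))

  -- Two distinct neighbours of the start e of a path, both further along the
  -- path: one of them lies beyond the second vertex, and its edge to e closes a cycle.
  chord-from-start : ∀ {e path y z} → Linked (Adj G) (e ∷ path) → Unique (e ∷ path) →
                     Adj G e y → Adj G e z → y ≢ z → y ∈ path → z ∈ path → Cycle
  chord-from-start _ _ _ _ y≢z (here refl) (here refl) = ⊥-elim (y≢z refl)
  chord-from-start {path = _ ∷ _ ∷ _} lk uq ey _ _ (there y∈) _ = proj₁ (close-at lk uq y∈ (adj-sym ey))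
  chord-from-start {path = _ ∷ _ ∷ _} lk uq _ ez _ (here _) (there z∈) = proj₁ (close-at lk uq z∈ (adj-sym ez))

  extend-or-close : ∀ {e path} → Linked (Adj G) (e ∷ path) → Unique (e ∷ path) → Branching e →
                    Cycle ⊎ ∃[ y ] (Branching y × Adj G y e × y ∉ e ∷ path)
  extend-or-close {e} {path} lk uq be with branching-neighbours be
  ... | y , z , ey , ez , y≢z , by , bz with y ∈? (e ∷ path) | z ∈? (e ∷ path)
  ...   | no y∉ | _ = inj₂ (y , by , adj-sym ey , y∉)
  ...   | yes _ | no z∉ = inj₂ (z , bz , adj-sym ez , z∉)
  ...   | yes y∈ | yes z∈ = inj₁ (chord-from-start lk uq ey ez y≢z (beyond-start ey y∈) (beyond-start ez z∈))
    where
    beyond-start : ∀ {v} → Adj G e v → v ∈ e ∷ path → v ∈ path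
    beyond-start ev (here refl) = ⊥-elim (adj-≢ ev refl)
    beyond-start _ (there v∈) = v∈

  -- Growing a path from a branching vertex must close a cycle before the path
  -- outgrows the vertex set; k bounds the number of remaining extensions.
  grow : ∀ k {e path} → Linked (Adj G) (e ∷ path) → Unique (e ∷ path) → Branching e →
         n G ≤ k + length (e ∷ path) → Cycle
  grow k {e} {path} lk uq be bound with extend-or-close lk uq be
  ... | inj₁ C = C
  ... | inj₂ (y , by , ye , y∉) with k
  ...   | zero = ⊥-elim (<-irrefl refl (≤-trans (unique-length≤ (y ∷ e ∷ path) (unique-cons y∉ uq)) bound))
  ...   | suc k′ = grow k′ (ye ∷ lk) (unique-cons y∉ uq) by (subst (n G ≤_) (≡-sym (+-suc k′ (length (e ∷ path)))) bound)

  find-cycle : Fin (n G) → Cycle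
  find-cycle x = let e , be = some-branching x in grow (n G) {e} {[]} [-] ([] ∷ []) be (m≤m+n (n G) 1)

  Triskelion : Set
  Triskelion = IsMinor triskelion G

  SmallerDone : Cycle → Set
  SmallerDone C = ∀ D → size D < size C → Triskelion

  -- In a cycle with no smaller cycles, x₀ has a neighbour off the cycle: by
  -- oddness it has a neighbour besides x₁ and the last vertex, and a further
  -- neighbour on the cycle would be a chord cutting off a smaller cycle.
  outer-at-start : ∀ C → SmallerDone C → Triskelion ⊎ ∃ (Outer C (x₀ C))
  outer-at-start C@(cycle x₀ x₁ x₂ rest lk uq cl) smaller
    with neighbour-outside odd x₀ (x₁ ∷ lastOf x₂ rest ∷ [])
           (unique-cons (λ { (here x₁≡last) → x₁∉ (subst (_∈ x₂ ∷ rest) (≡-sym x₁≡last) (lastOf-∈ x₂ rest)) })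
                        (unique-cons (λ ()) []))
           (λ { (here refl) → Linked.head lk ; (there (here refl)) → adj-sym cl }) refl
    where
    x₁∉ : x₁ ∉ x₂ ∷ rest
    x₁∉ = Unique[x∷xs]⇒x∉xs (AllPairs.tail uq)
  ... | y , x₀y , y∉ with y ∈? vertices C
  ...   | no y∉C = inj₂ (y , x₀y , y∉C)
  ...   | yes (here refl) = ⊥-elim (adj-≢ x₀y refl)
  ...   | yes (there (here refl)) = ⊥-elim (y∉ (here refl))
  ...   | yes (there (there y∈)) =
          let D , shorter = close-at lk uq y∈ (adj-sym x₀y) in
          inj₁ (smaller D (shorter λ y≡last → y∉ (there (here y≡last))))

  -- The same at x₁ and x₂, applied to the rotations of C (which have the same
  -- size and vertices).
  outer-neighbours : ∀ C → SmallerDone C →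
    Triskelion ⊎ (∃ (Outer C (x₀ C)) × ∃ (Outer C (x₁ C)) × ∃ (Outer C (x₂ C)))
  outer-neighbours C smaller
    with outer-at-start C smaller | outer-at-start (rotate C) smaller′ | outer-at-start (rotate (rotate C)) smaller″
    where
    smaller′ : SmallerDone (rotate C)
    smaller′ D lt = smaller D (subst (size D <_) (rotate-size C) lt)
    smaller″ : SmallerDone (rotate (rotate C))
    smaller″ D lt = smaller′ D (subst (size D <_) (rotate-size (rotate C)) lt)
  ... | inj₁ done | _ | _ = inj₁ done
  ... | _ | inj₁ done | _ = inj₁ done
  ... | _ | _ | inj₁ done = inj₁ done
  ... | inj₂ o₀ | inj₂ (a₁ , x₁a₁ , a₁∉) | inj₂ (a₂ , x₂a₂ , a₂∉) =
        inj₂ (o₀ , (a₁ , x₁a₁ , a₁∉ ∘ rotate-⊇ C) , (a₂ , x₂a₂ , a₂∉ ∘ rotate-⊇ (rotate C) ∘ rotate-⊇ C))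

  outer-beyond : ∀ C v (M : List V) → Unique M → (∀ {y} → y ∈ M → Adj G v y) → length M % 2 ≡ 0 →
                 (∀ {y} → Adj G v y → y ∈ vertices C → y ∈ M) → ∃[ y ] (Outer C v y × y ∉ M)
  outer-beyond C v M uM M⊆N even inner with neighbour-outside odd v M uM M⊆N even
  ... | y , vy , y∉M = y , (vy , λ y∈C → y∉M (inner vy y∈C)) , y∉M

  -- If the neighbours of a cycle vertex v on the cycle are exactly an even
  -- list L, its neighbours off the cycle are odd in number: a single vertex,
  -- or at least three, which avoid any two given vertices.
  outer-shape : ∀ C v (L : List V) → Unique L → (∀ {y} → y ∈ L → Adj G v y) → length L % 2 ≡ 0 →
                (∀ {y} → y ∈ L → y ∈ vertices C) → (∀ {y} → Adj G v y → y ∈ vertices C → y ∈ L) →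
                Shape (Outer C v)
  outer-shape C v L uL L⊆N even L⊆C inner with outer-beyond C v L uL L⊆N even inner
  ... | s , os , s∉L with any? (λ y → (adj? v y ×-dec ¬? (y ∈? vertices C)) ×-dec ¬? (y ≟ s))
  ...   | no none = single s os λ {y} oy → decidable-stable (y ≟ s) λ y≢s → none (y , oy , y≢s)
  ...   | yes (s′ , os′ , s′≢s)
    with outer-beyond C v (s ∷ s′ ∷ L)
           (unique-cons (λ { (here s≡s′) → s′≢s (≡-sym s≡s′) ; (there s∈L) → s∉L s∈L })
                        (unique-cons (proj₂ os′ ∘ L⊆C) uL))
           (λ { (here refl) → proj₁ os ; (there (here refl)) → proj₁ os′ ; (there (there y∈L)) → L⊆N y∈L }) even
           (λ vy y∈C → there (there (inner vy y∈C)))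
  ...     | s″ , os″ , s″∉ =
            spread (three-avoid _≟_ os os′ os″ (≢-sym s′≢s) (λ s≡s″ → s″∉ (here (≡-sym s≡s″)))
                                (λ s′≡s″ → s″∉ (there (here (≡-sym s′≡s″)))))

  -- Two cycle vertices whose neighbours on the cycle agree (apart from each
  -- other) cannot have the same single neighbour off the cycle: they would be twins.
  outer-not-same-singleton : ∀ C {u v} → u ≢ v →
    (∀ {z} → Adj G u z → z ≢ v → z ∈ vertices C → Adj G v z) →
    (∀ {z} → Adj G v z → z ≢ u → z ∈ vertices C → Adj G u z) →
    NotSameSingleton (Outer C u) (Outer C v)
  outer-not-same-singleton C {u} {v} u≢v insideU insideV (us , _) (vs , _) onlyU onlyV =
    no-twins u≢v (λ uz z≢v → shared insideU onlyU vs uz z≢v) (λ vz z≢u → shared insideV onlyV us vz z≢u)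
    where
    shared : ∀ {p q s z} → (Adj G p z → z ≢ q → z ∈ vertices C → Adj G q z) →
             (∀ {y} → Outer C p y → y ≡ s) → Adj G q s → Adj G p z → z ≢ q → Adj G q z
    shared {z = z} inside only qs pz z≢q with z ∈? vertices C
    ... | yes z∈C = inside pz z≢q z∈C
    ... | no z∉C = subst (Adj G _) (≡-sym (only (pz , z∉C))) qs

  triangle-pair : ∀ C {u v t} → u ≢ v → Adj G u t → Adj G v t →
                  (∀ {z} → z ∈ vertices C → z ≡ u ⊎ z ≡ v ⊎ z ≡ t) → NotSameSingleton (Outer C u) (Outer C v)
  triangle-pair C u≢v ut vt members = outer-not-same-singleton C u≢v
    (λ uz z≢v z∈C → inside vt uz z≢v (members z∈C)) (λ vz z≢u z∈C → inside ut vz z≢u (swap (members z∈C)))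
    where
    swap : ∀ {z u v t : V} → z ≡ u ⊎ z ≡ v ⊎ z ≡ t → z ≡ v ⊎ z ≡ u ⊎ z ≡ t
    swap (inj₁ e) = inj₂ (inj₁ e)
    swap (inj₂ (inj₁ e)) = inj₁ e
    swap (inj₂ (inj₂ e)) = inj₂ (inj₂ e)
    inside : ∀ {u v t z} → Adj G v t → Adj G u z → z ≢ v → z ≡ u ⊎ z ≡ v ⊎ z ≡ t → Adj G v z
    inside _ uz _ (inj₁ refl) = ⊥-elim (adj-≢ uz refl)
    inside _ _ z≢v (inj₂ (inj₁ refl)) = ⊥-elim (z≢v refl)
    inside vt _ _ (inj₂ (inj₂ refl)) = vt

  -- Every triangle yields the triskelion: the outer neighbourhoods of its
  -- vertices have distinct representatives, which serve as pendants.
  triangle⇒triskelion : ∀ {x₀ x₁ x₂} (lk : Linked (Adj G) (x₀ ∷ x₁ ∷ x₂ ∷ [])) (uq : Unique (x₀ ∷ x₁ ∷ x₂ ∷ [])) →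
                        Adj G x₂ x₀ → Triskelion
  triangle⇒triskelion {x₀} {x₁} {x₂} lk@(x₀x₁ ∷ x₁x₂ ∷ [-]) uq@((x₀≢x₁ ∷ x₀≢x₂ ∷ []) ∷ (x₁≢x₂ ∷ []) ∷ [] ∷ []) x₂x₀
    with distinct-representatives x₀ shape₀ shape₁ shape₂
           (triangle-pair C x₀≢x₁ (adj-sym x₂x₀) x₁x₂
              λ { (here e) → inj₁ e ; (there (here e)) → inj₂ (inj₁ e) ; (there (there (here e))) → inj₂ (inj₂ e) })
           (triangle-pair C x₀≢x₂ x₀x₁ (adj-sym x₁x₂)
              λ { (here e) → inj₁ e ; (there (here e)) → inj₂ (inj₂ e) ; (there (there (here e))) → inj₂ (inj₁ e) })
           (triangle-pair C x₁≢x₂ (adj-sym x₀x₁) x₂x₀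
              λ { (here e) → inj₂ (inj₂ e) ; (there (here e)) → inj₁ e ; (there (there (here e))) → inj₂ (inj₁ e) })
    where
    C : Cycle
    C = cycle x₀ x₁ x₂ [] lk uq x₂x₀
    shape₀ : Shape (Outer C x₀)
    shape₀ = outer-shape C x₀ (x₁ ∷ x₂ ∷ []) ((x₁≢x₂ ∷ []) ∷ [] ∷ [])
      (λ { (here refl) → x₀x₁ ; (there (here refl)) → adj-sym x₂x₀ }) refl there
      λ { x₀y (here refl) → ⊥-elim (adj-≢ x₀y refl) ; _ (there y∈) → y∈ }
    shape₁ : Shape (Outer C x₁)
    shape₁ = outer-shape C x₁ (x₀ ∷ x₂ ∷ []) ((x₀≢x₂ ∷ []) ∷ [] ∷ [])
      (λ { (here refl) → adj-sym x₀x₁ ; (there (here refl)) → x₁x₂ })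
      refl (λ { (here e) → here e ; (there (here e)) → there (there (here e)) })
      λ { _ (here e) → here e ; x₁y (there (here refl)) → ⊥-elim (adj-≢ x₁y refl) ; _ (there (there y∈)) → there y∈ }
    shape₂ : Shape (Outer C x₂)
    shape₂ = outer-shape C x₂ (x₀ ∷ x₁ ∷ []) ((x₀≢x₁ ∷ []) ∷ [] ∷ [])
      (λ { (here refl) → x₂x₀ ; (there (here refl)) → adj-sym x₁x₂ })
      refl (λ { (here e) → here e ; (there (here e)) → there (here e) })
      λ { _ (here e) → here e ; _ (there (here e)) → there (here e) ; x₂y (there (there (here refl))) → ⊥-elim (adj-≢ x₂y refl) }
  ... | a₀ , a₁ , a₂ , o₀ , o₁ , o₂ , a₀≢a₁ , a₀≢a₂ , a₁≢a₂ =
        pendants⇒triskelion (cycle x₀ x₁ x₂ [] lk uq x₂x₀) (pendants a₀ a₁ a₂ o₀ o₁ o₂ a₀≢a₁ a₀≢a₂ a₁≢a₂)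

  not-both : ∀ {z u v} → Adj G z u → Adj G z v → ¬ ((Adj G z u × ¬ Adj G z v) ⊎ (¬ Adj G z u × Adj G z v))
  not-both _ zv (inj₁ (_ , ¬zv)) = ¬zv zv
  not-both zu _ (inj₂ (¬zu , _)) = ¬zu zu

  -- In a square x₀ x₁ x₂ x₃, a vertex adjacent to exactly one of x₀ and x₂ is
  -- off the square, since x₁ and x₃ are adjacent to both.
  off-square : ∀ {x₀ x₁ x₂ x₃ w} → Adj G x₀ x₁ → Adj G x₁ x₂ → Adj G x₂ x₃ → Adj G x₃ x₀ → w ≢ x₀ → w ≢ x₂ →
               (Adj G w x₀ × ¬ Adj G w x₂) ⊎ (¬ Adj G w x₀ × Adj G w x₂) → w ∉ x₀ ∷ x₁ ∷ x₂ ∷ x₃ ∷ []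
  off-square _ _ _ _ w≢x₀ _ _ (here refl) = w≢x₀ refl
  off-square x₀x₁ x₁x₂ _ _ _ _ one (there (here refl)) = not-both (adj-sym x₀x₁) x₁x₂ one
  off-square _ _ _ _ _ w≢x₂ _ (there (there (here refl))) = w≢x₂ refl
  off-square _ _ x₂x₃ x₃x₀ _ _ one (there (there (there (here refl)))) = not-both x₃x₀ (adj-sym x₂x₃) one

  -- On a cycle of length at least four, let x₀ and x₂ have a common neighbour
  -- a off the cycle.  The square a x₀ x₁ x₂ is smaller unless the cycle is
  -- itself a square x₀ x₁ x₂ x₃; then a vertex w distinguishing x₀ from x₂ is
  -- off the cycle and replaces a as pendant at x₀ or at x₂, unless w = a₁,
  -- when w x₁ and x₀ or x₂ form a smaller triangle.
  common-outer⇒triskelion : ∀ C → SmallerDone C → 1 ≤ size C → ∀ {a a₁} →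
    Outer C (x₀ C) a → Outer C (x₁ C) a₁ → Outer C (x₂ C) a → a ≢ a₁ → Triskelion
  common-outer⇒triskelion (cycle _ _ _ [] _ _ _) _ ()
  common-outer⇒triskelion (cycle x₀ x₁ x₂ (x₃ ∷ _ ∷ _) (x₀x₁ ∷ x₁x₂ ∷ _) ((x₀≢x₁ ∷ x₀≢x₂ ∷ _) ∷ (x₁≢x₂ ∷ _) ∷ _) _)
                          smaller _ (x₀a , a∉) _ (x₂a , _) _ =
    smaller (square-cycle (adj-sym x₀a) x₀x₁ x₁x₂ x₂a (∉⇒≢ a∉ (here refl)) (∉⇒≢ a∉ (there (here refl)))
                          (∉⇒≢ a∉ (there (there (here refl)))) x₀≢x₁ x₀≢x₂ x₁≢x₂) (s≤s (s≤s z≤n))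
  common-outer⇒triskelion C@(cycle x₀ x₁ x₂ (x₃ ∷ []) (x₀x₁ ∷ x₁x₂ ∷ x₂x₃ ∷ _) ((_ ∷ x₀≢x₂ ∷ _) ∷ _) x₃x₀)
                          smaller _ {a} {a₁} (x₀a , a∉) o₁ (x₂a , _) a≢a₁ with distinguish x₀ x₂ x₀≢x₂
  ... | w , w≢x₀ , w≢x₂ , one with off-square x₀x₁ x₁x₂ x₂x₃ x₃x₀ w≢x₀ w≢x₂ one | w ≟ a₁ | one
  ...   | w∉ | yes refl | inj₁ (wx₀ , _) =
          smaller (outer-triangle C (here refl) (there (here refl)) x₀x₁ (adj-sym wx₀ , w∉) o₁) (s≤s z≤n)
  ...   | w∉ | yes refl | inj₂ (_ , wx₂) =
          smaller (outer-triangle C (there (here refl)) (there (there (here refl))) x₁x₂ o₁ (adj-sym wx₂ , w∉)) (s≤s z≤n)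
  ...   | w∉ | no w≢a₁ | inj₁ (wx₀ , ¬wx₂) =
          pendants⇒triskelion C (pendants w a₁ a (adj-sym wx₀ , w∉) o₁ (x₂a , a∉) w≢a₁ (λ { refl → ¬wx₂ (adj-sym x₂a) }) (≢-sym a≢a₁))
  ...   | w∉ | no w≢a₁ | inj₂ (¬wx₀ , wx₂) =
          pendants⇒triskelion C (pendants a a₁ w (x₀a , a∉) o₁ (adj-sym wx₂ , w∉) a≢a₁ (λ { refl → ¬wx₀ (adj-sym x₀a) }) (≢-sym w≢a₁))

  -- A cycle of length at least four with no smaller cycles yields the
  -- triskelion: x₀ x₁ x₂ have neighbours a₀ a₁ a₂ off the cycle, which are
  -- pendants unless two coincide; a₀ = a₁ or a₁ = a₂ closes a smaller triangle.
  long-cycle⇒triskelion : ∀ C → SmallerDone C → 1 ≤ size C → Triskelion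
  long-cycle⇒triskelion C smaller long with outer-neighbours C smaller
  ... | inj₁ done = done
  ... | inj₂ ((a₀ , o₀) , (a₁ , o₁) , (a₂ , o₂)) with a₀ ≟ a₁ | a₁ ≟ a₂ | a₀ ≟ a₂
  ...   | yes refl | _ | _ =
          smaller (outer-triangle C (here refl) (there (here refl)) (Linked.head (linked C)) o₀ o₁) long
  ...   | no _ | yes refl | _ =
          smaller (outer-triangle C (there (here refl)) (there (there (here refl))) (Linked.head (Linked.tail (linked C))) o₁ o₂) long
  ...   | no a₀≢a₁ | no a₁≢a₂ | no a₀≢a₂ = pendants⇒triskelion C (pendants a₀ a₁ a₂ o₀ o₁ o₂ a₀≢a₁ a₀≢a₂ a₁≢a₂)
  ...   | no a₀≢a₁ | no _ | yes refl = common-outer⇒triskelion C smaller long o₀ o₁ o₂ a₀≢a₁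

  -- Every cycle yields the triskelion, by induction on its size: a shortest
  -- cycle is a triangle or a long cycle without smaller cycles.
  cycle⇒triskelion : Cycle → Triskelion
  cycle⇒triskelion C = <-rec (λ m → ∀ D → size D ≡ m → Triskelion) by-size (size C) C refl
    where
    by-size : ∀ m → (∀ {k} → k < m → ∀ D → size D ≡ k → Triskelion) → ∀ D → size D ≡ m → Triskelion
    by-size _ _ (cycle _ _ _ [] lk uq cl) refl = triangle⇒triskelion lk uq cl
    by-size _ below D@(cycle _ _ _ (_ ∷ _) _ _ _) refl = long-cycle⇒triskelion D (λ D′ lt → below lt D′ refl) (s≤s z≤n)

corollary3p3 : (G : Graph) → 1 ≤ n G → IrreduciblyOdd G → IsMinor triskelion G
corollary3p3 G nonempty irreducibly-odd = cycle⇒triskelion (find-cycle (fromℕ< nonempty))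
  where open Irreducible G irreducibly-odd
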